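{- Let $n\in\mathbb{N}$ and let $\alpha$ be a unit-interval parking function of length $n$. Then $\alpha$ is a prime parking function if and only if $D(\alpha)=n-1$.
   Context: A parking function of length $n$ is $\alpha=(a_1,\dots,a_n)\in[n]^n$ such that, when cars $1,\dots,n$ arrive in order on a one-way street with spots $1,\dots,n$ and car $i$ parks in the first unoccupied spot $\ge a_i$, every car parks. If car $i$ parks in spot $s_i$, its displacement is $s_i-a_i$, and $D(\alpha)=\sum_i (s_i-a_i)$. A unit-interval parking function is a parking function in which every car has displacement at most $1$. A parking function $\alpha$ has a breakpoint at $k$ if $|\{i: a_i\le k\}|=k$; it is prime if its only breakpoint is at $n$. -}

module Defs where

open import Data.Nat using (ℕ; zero; suc; _+_; _∸_; _≤_; _≤?_; _≟_)
open import Data.Bool using (Bool; true; false; if_then_else_)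
open import Data.List using (List; []; _∷_; length; filter; zipWith)
open import Data.Nat.ListAction using (sum)
open import Data.List.Membership.DecPropositional _≟_ using (_∈?_)
open import Data.List.Relation.Unary.All using (All)
open import Data.Maybe using (Maybe; just; nothing)
open import Data.Product using (Σ; _×_; _,_)
open import Relation.Nullary using (¬_; does)
open import Relation.Binary.PropositionalEquality using (_≡_)

-- A preference sequence α = (a₁,…,aₙ) is a list of naturals.
-- Spots are numbered 1,…,n.

firstFree : ℕ → List ℕ → ℕ → ℕ → Maybe ℕ
firstFree n occ s zero = nothing
firstFree n occ s (suc fuel) with does (s ≤? n)
... | false = nothing
... | true with does (s ∈? occ)
...   | true  = firstFree n occ (suc s) fuel
...   | false = just s

parkFrom : ℕ → List ℕ → List ℕ → Maybe (List ℕ)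
parkFrom n occ [] = just []
parkFrom n occ (a ∷ as) with firstFree n occ a n
... | nothing = nothing
... | just s with parkFrom n (s ∷ occ) as
...   | nothing = nothing
...   | just ss = just (s ∷ ss)

park : ℕ → List ℕ → Maybe (List ℕ)
park n α = parkFrom n [] α

InRange : ℕ → List ℕ → Set
InRange n α = (length α ≡ n) × All (λ a → 1 ≤ a × a ≤ n) α

ParkingFunction : ℕ → List ℕ → Set
ParkingFunction n α = InRange n α × Σ (List ℕ) (λ s → park n α ≡ just s)

-- displacements s_i - a_i (s_i ≥ a_i always holds in the process)
displacements : List ℕ → List ℕ → List ℕ
displacements s α = zipWith _∸_ s α

D : (n : ℕ) → List ℕ → ℕ
D n α with park n α
... | just s  = sum (displacements s α)
... | nothing = 0

UnitIntervalPF : ℕ → List ℕ → Set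
UnitIntervalPF n α =
  ParkingFunction n α ×
  (∀ s → park n α ≡ just s → All (λ d → d ≤ 1) (displacements s α))

countLeq : ℕ → List ℕ → ℕ
countLeq k α = length (filter (λ a → a ≤? k) α)

Breakpoint : List ℕ → ℕ → Set
Breakpoint α k = countLeq k α ≡ k

Prime : ℕ → List ℕ → Set
Prime n α = ∀ k → 1 ≤ k → k ≤ n → Breakpoint α k → k ≡ n

-- Say car i crosses the gap k (between spots k and k + 1) when a_i ≤ k < s_i.
-- Every car with displacement 1 crosses exactly one gap k ∈ [1, n − 1],
-- so D(α) is the total number of crossings.  Because the parked spots form a
-- permutation of [n], #{i : a_i ≤ k} = k + #(crossings of gap k), so α has a
-- breakpoint at k exactly when nobody crosses gap k; and at most one car can
-- cross gap k, namely the one parked in spot k + 1.  Hence D(α) ≤ n − 1, with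
-- equality iff every gap k < n is crossed, i.e. iff α is prime.
module Submission where

open import Defs
open import Data.Nat
  using (ℕ; zero; suc; _+_; _∸_; _⊓_; _≤_; _<_; _≤?_; _≤ᵇ_; _≟_; z≤n; s≤s; s≤s⁻¹; pred)
open import Data.Nat.Properties
open import Data.Nat.ListAction using (sum)
open import Algebra.Properties.CommutativeSemigroup +-commutativeSemigroup using (interchange)
open import Data.List using (List; []; _∷_; length; filter; zipWith)
open import Data.List.Membership.Propositional using (_∉_)
open import Data.List.Membership.DecPropositional _≟_ using (_∈?_)
open import Data.List.Relation.Unary.Any using (here; there)
open import Data.List.Relation.Unary.All as All using (All; []; _∷_)
open import Data.List.Relation.Unary.All.Properties using (all-filter; filter⁺)
open import Data.List.Relation.Unary.Unique.Propositional using (Unique; []; _∷_)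
import Data.List.Relation.Unary.Unique.Propositional.Properties as Unique
open import Data.List.Relation.Binary.Pointwise as Pointwise
  using (Pointwise; []; _∷_; Pointwise-length; All-resp-Pointwise)
open import Data.Maybe using (just)
open import Data.Product using (_×_; _,_; proj₁; proj₂)
open import Data.Sum using (inj₁; inj₂)
open import Data.Bool using (true; false; _∧_; not; if_then_else_)
open import Function using (_∘_)
open import Relation.Nullary using (yes; no; ¬?; ofʸ; ofⁿ; contradiction)
open import Relation.Unary using (Decidable)
open import Relation.Binary.PropositionalEquality
  using (_≡_; _≢_; refl; sym; trans; cong; cong₂; ≢-sym; module ≡-Reasoning)

firstFree-spec : ∀ n occ a fuel {t} → firstFree n occ a fuel ≡ just t →
                 a ≤ t × t ≤ n × t ∉ occ
firstFree-spec n occ a (suc fuel) eq with a ≤ᵇ n | ≤ᵇ-reflects-≤ a n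
... | true | ofʸ a≤n with a ∈? occ
...   | no a∉occ with refl ← eq = ≤-refl , a≤n , a∉occ
...   | yes _ with a<t , t≤n , t∉occ ← firstFree-spec n occ (suc a) fuel eq =
  ≤-trans (n≤1+n a) a<t , t≤n , t∉occ

parkFrom-spec : ∀ n occ α {s} → parkFrom n occ α ≡ just s →
                Pointwise (λ a t → a ≤ t × t ≤ n) α s × Unique s × All (_∉ occ) s
parkFrom-spec n occ [] refl = [] , [] , []
parkFrom-spec n occ (a ∷ α) eq with firstFree n occ a n in parks-a
... | just t with parkFrom n (t ∷ occ) α in parks-α
...   | just s with refl ← eq
  with a≤t , t≤n , t∉occ ← firstFree-spec n occ a n parks-a
     | steps , unique , fresh ← parkFrom-spec n (t ∷ occ) α parks-α =
  (a≤t , t≤n) ∷ steps ,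
  All.map (λ u∉ t≡u → u∉ (here (sym t≡u))) fresh ∷ unique ,
  t∉occ ∷ All.map (λ u∉ u∈ → u∉ (there u∈)) fresh

length-filter-split : ∀ {P : ℕ → Set} (P? : Decidable P) xs →
                      length (filter P? xs) + length (filter (¬? ∘ P?) xs) ≡ length xs
length-filter-split P? [] = refl
length-filter-split P? (x ∷ xs) with P? x
... | yes _ = cong suc (length-filter-split P? xs)
... | no _  = trans (+-suc _ _) (cong suc (length-filter-split P? xs))

unique∧all≡⇒length≤1 : ∀ {A : Set} {x : A} {xs} → Unique xs → All (_≡ x) xs → length xs ≤ 1
unique∧all≡⇒length≤1 [] [] = z≤n
unique∧all≡⇒length≤1 (_ ∷ []) (_ ∷ []) = ≤-refl
unique∧all≡⇒length≤1 ((y≢z ∷ _) ∷ _) (y≡x ∷ z≡x ∷ _) = contradiction (trans y≡x (sym z≡x)) y≢z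

unique-interval-length : ∀ lo d {xs} → Unique xs →
                         All (λ x → lo < x × x ≤ d + lo) xs → length xs ≤ d
unique-interval-length lo zero [] [] = z≤n
unique-interval-length lo zero (_ ∷ _) ((lo<x , x≤lo) ∷ _) = contradiction lo<x (≤⇒≯ x≤lo)
unique-interval-length lo (suc d) {xs} unique inInterval = begin
  length xs                                  ≡⟨ length-filter-split (_≟ top) xs ⟨
  length (filter (_≟ top) xs) + length below ≤⟨ +-mono-≤ atTop belowTop ⟩
  1 + d                                      ∎
  where
  open ≤-Reasoning
  top   = suc (d + lo)
  below = filter (¬? ∘ (_≟ top)) xs
  atTop : length (filter (_≟ top) xs) ≤ 1
  atTop = unique∧all≡⇒length≤1 (Unique.filter⁺ (_≟ top) unique) (all-filter (_≟ top) xs)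
  belowTop : length below ≤ d
  belowTop = unique-interval-length lo d (Unique.filter⁺ _ unique)
    (All.zipWith (λ ((lo<x , x≤top) , x≢top) → lo<x , s≤s⁻¹ (≤∧≢⇒< x≤top x≢top))
                 (filter⁺ _ inInterval , all-filter _ xs))

countLeq-permutation : ∀ {n k s} → k ≤ n → Unique s → All (λ t → 1 ≤ t × t ≤ n) s →
                       length s ≡ n → countLeq k s ≡ k
countLeq-permutation {n} {k} {s} k≤n unique inRange length≡n =
  ≤-antisym low≤k (+-cancelʳ-≤ (length high) k (length low) (begin
    k + length high         ≤⟨ +-monoʳ-≤ k high≤n∸k ⟩
    k + (n ∸ k)             ≡⟨ m+[n∸m]≡n k≤n ⟩
    n                       ≡⟨ trans (length-filter-split (_≤? k) s) length≡n ⟨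
    length low + length high ∎))
  where
  open ≤-Reasoning
  low  = filter (_≤? k) s
  high = filter (¬? ∘ (_≤? k)) s
  low≤k : length low ≤ k
  low≤k = unique-interval-length 0 k (Unique.filter⁺ _ unique)
    (All.zipWith (λ ((1≤t , _) , t≤k) → 1≤t , m≤n⇒m≤n+o 0 t≤k)
                 (filter⁺ _ inRange , all-filter _ s))
  high≤n∸k : length high ≤ n ∸ k
  high≤n∸k = unique-interval-length k (n ∸ k) (Unique.filter⁺ _ unique)
    (All.zipWith (λ ((_ , t≤n) , t≰k) → ≰⇒> t≰k , ≤-trans t≤n (≤-reflexive (sym (m∸n+n≡m k≤n))))
                 (filter⁺ _ inRange , all-filter _ s))

crosses : ℕ → ℕ → ℕ → ℕ
crosses k a t = if (a ≤ᵇ k) ∧ not (t ≤ᵇ k) then 1 else 0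

crossings : ℕ → List ℕ → List ℕ → ℕ
crossings k α s = sum (zipWith (crosses k) α s)

crosses≤1 : ∀ k a t → crosses k a t ≤ 1
crosses≤1 k a t with a ≤ᵇ k | t ≤ᵇ k
... | true  | true  = z≤n
... | true  | false = ≤-refl
... | false | _     = z≤n

crosses-≢ : ∀ {k a t} → t ≤ suc a → t ≢ suc k → crosses k a t ≡ 0
crosses-≢ {k} {a} {t} t≤1+a t≢1+k
  with a ≤ᵇ k | ≤ᵇ-reflects-≤ a k | t ≤ᵇ k | ≤ᵇ-reflects-≤ t k
... | true  | ofʸ a≤k | false | ofⁿ t≰k =
  contradiction (≤-antisym (≤-trans t≤1+a (s≤s a≤k)) (≰⇒> t≰k)) t≢1+k
... | true  | _       | true  | _       = refl
... | false | _       | _     | _       = refl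

crosses-≤ : ∀ {k a t} → t ≤ k → crosses k a t ≡ 0
crosses-≤ {k} {a} {t} t≤k with a ≤ᵇ k | t ≤ᵇ k | ≤ᵇ-reflects-≤ t k
... | true  | true  | _       = refl
... | true  | false | ofⁿ t≰k = contradiction t≤k t≰k
... | false | _     | _       = refl

crosses-< : ∀ {k a t} → k < t → crosses k a t + (k ∸ a) ≡ suc k ∸ a
crosses-< {k} {a} {t} k<t with a ≤ᵇ k | ≤ᵇ-reflects-≤ a k | t ≤ᵇ k | ≤ᵇ-reflects-≤ t k
... | true  | ofʸ a≤k | false | _       = sym (+-∸-assoc 1 a≤k)
... | true  | _       | true  | ofʸ t≤k = contradiction t≤k (<⇒≱ k<t)
... | false | ofⁿ a≰k | _     | _       =
  trans (m≤n⇒m∸n≡0 (<⇒≤ (≰⇒> a≰k))) (sym (m≤n⇒m∸n≡0 (≰⇒> a≰k)))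

countLeq-crossings : ∀ k {α s} → Pointwise _≤_ α s →
                     countLeq k α ≡ countLeq k s + crossings k α s
countLeq-crossings k [] = refl
countLeq-crossings k {a ∷ α} {t ∷ s} (a≤t ∷ α≤s)
  with ih ← countLeq-crossings k α≤s
     | a ≤ᵇ k | ≤ᵇ-reflects-≤ a k | t ≤ᵇ k | ≤ᵇ-reflects-≤ t k
... | true  | _        | true  | _       = cong suc ih
... | true  | _        | false | _       = trans (cong suc ih) (sym (+-suc _ _))
... | false | ofⁿ a≰k  | true  | ofʸ t≤k = contradiction (≤-trans a≤t t≤k) a≰k
... | false | _        | false | _       = ih

crossings-≢ : ∀ {k α s} → Pointwise (λ a t → t ≤ suc a) α s → All (_≢ suc k) s →
              crossings k α s ≡ 0
crossings-≢ [] [] = refl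
crossings-≢ (t≤1+a ∷ steps) (t≢1+k ∷ ts≢1+k) =
  cong₂ _+_ (crosses-≢ t≤1+a t≢1+k) (crossings-≢ steps ts≢1+k)

unique⇒crossings≤1 : ∀ {k α s} → Pointwise (λ a t → t ≤ suc a) α s → Unique s →
              crossings k α s ≤ 1
unique⇒crossings≤1 [] [] = z≤n
unique⇒crossings≤1 {k} {a ∷ α} {t ∷ s} (t≤1+a ∷ steps) (t≢s ∷ unique) with t ≟ suc k
... | yes refl =
  +-mono-≤ (crosses≤1 k a t) (≤-reflexive (crossings-≢ steps (All.map ≢-sym t≢s)))
... | no t≢1+k =
  ≤-trans (≤-reflexive (cong (_+ _) (crosses-≢ t≤1+a t≢1+k))) (unique⇒crossings≤1 steps unique)

sumTo : (ℕ → ℕ) → ℕ → ℕ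
sumTo f zero    = 0
sumTo f (suc m) = f (suc m) + sumTo f m

sumTo-+ : ∀ f g m → sumTo (λ k → f k + g k) m ≡ sumTo f m + sumTo g m
sumTo-+ f g zero    = refl
sumTo-+ f g (suc m) =
  trans (cong (f (suc m) + g (suc m) +_) (sumTo-+ f g m))
        (interchange (f (suc m)) (g (suc m)) (sumTo f m) (sumTo g m))

sumTo-zero : ∀ m → sumTo (λ _ → 0) m ≡ 0
sumTo-zero zero    = refl
sumTo-zero (suc m) = sumTo-zero m

sumTo-≤ : ∀ {f} m → (∀ k → f k ≤ 1) → sumTo f m ≤ m
sumTo-≤ zero    f≤1 = z≤n
sumTo-≤ (suc m) f≤1 = +-mono-≤ (f≤1 (suc m)) (sumTo-≤ m f≤1)

sumTo-< : ∀ {f} m → (∀ k → f k ≤ 1) → ∀ {k} → 1 ≤ k → k ≤ m → f k ≡ 0 → sumTo f m < m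
sumTo-< zero    _ (s≤s _) ()
sumTo-< {f} (suc m) f≤1 {k} 1≤k k≤1+m fk≡0 with m≤n⇒m<n∨m≡n k≤1+m
... | inj₁ k<1+m = +-mono-≤-< (f≤1 (suc m)) (sumTo-< m f≤1 1≤k (s≤s⁻¹ k<1+m) fk≡0)
... | inj₂ refl  = s≤s (≤-trans (≤-reflexive (cong (_+ sumTo f m) fk≡0)) (sumTo-≤ m f≤1))

sumTo-ones : ∀ {f} m → (∀ {k} → 1 ≤ k → k ≤ m → f k ≡ 1) → sumTo f m ≡ m
sumTo-ones zero    _    = refl
sumTo-ones (suc m) f≡1 =
  cong₂ _+_ (f≡1 (s≤s z≤n) ≤-refl) (sumTo-ones m (λ 1≤k → f≡1 1≤k ∘ m≤n⇒m≤1+n))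

-- The gaps crossed by a car preferring a ≥ 1 and parked at t are a, …, t − 1.
sumTo-crosses : ∀ {a} t m → 1 ≤ a → sumTo (λ k → crosses k a t) m ≡ t ⊓ suc m ∸ a
sumTo-crosses t zero    1≤a = sym (m≤n⇒m∸n≡0 (≤-trans (m⊓n≤n t 1) 1≤a))
sumTo-crosses {a} t (suc m) 1≤a with t ≤? suc m
... | yes t≤1+m = begin
  crosses (suc m) a t + sumTo (λ k → crosses k a t) m
    ≡⟨ cong₂ _+_ (crosses-≤ {a = a} t≤1+m) (sumTo-crosses t m 1≤a) ⟩
  t ⊓ suc m ∸ a
    ≡⟨ cong (_∸ a) (trans (m≤n⇒m⊓n≡m t≤1+m) (sym (m≤n⇒m⊓n≡m (m≤n⇒m≤1+n t≤1+m)))) ⟩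
  t ⊓ suc (suc m) ∸ a ∎
  where open ≡-Reasoning
... | no t≰1+m = begin
  crosses (suc m) a t + sumTo (λ k → crosses k a t) m
    ≡⟨ cong (crosses (suc m) a t +_) (sumTo-crosses t m 1≤a) ⟩
  crosses (suc m) a t + (t ⊓ suc m ∸ a)
    ≡⟨ cong (λ u → crosses (suc m) a t + (u ∸ a)) (m≥n⇒m⊓n≡n (<⇒≤ 1+m<t)) ⟩
  crosses (suc m) a t + (suc m ∸ a)
    ≡⟨ crosses-< {a = a} 1+m<t ⟩
  suc (suc m) ∸ a
    ≡⟨ cong (_∸ a) (m≥n⇒m⊓n≡n 1+m<t) ⟨
  t ⊓ suc (suc m) ∸ a ∎
  where
  open ≡-Reasoning
  1+m<t = ≰⇒> t≰1+m

sumTo-crossings : ∀ m {α s} → Pointwise (λ a t → 1 ≤ a × t ≤ suc m) α s →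
                  sumTo (λ k → crossings k α s) m ≡ sum (displacements s α)
sumTo-crossings m [] = sumTo-zero m
sumTo-crossings m {a ∷ α} {t ∷ s} ((1≤a , t≤1+m) ∷ steps) = begin
  sumTo (λ k → crosses k a t + crossings k α s) m
    ≡⟨ sumTo-+ (λ k → crosses k a t) (λ k → crossings k α s) m ⟩
  sumTo (λ k → crosses k a t) m + sumTo (λ k → crossings k α s) m
    ≡⟨ cong₂ _+_ (sumTo-crosses t m 1≤a) (sumTo-crossings m steps) ⟩
  t ⊓ suc m ∸ a + sum (displacements s α)
    ≡⟨ cong (λ u → u ∸ a + _) (m≤n⇒m⊓n≡m t≤1+m) ⟩
  t ∸ a + sum (displacements s α) ∎
  where open ≡-Reasoning

UnitDisplaced : ℕ → ℕ → ℕ → Set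
UnitDisplaced n a t = 1 ≤ a × a ≤ t × t ≤ n × t ≤ suc a

module UnitIntervalOutcome {n α s} (pf : UnitIntervalPF n α) (parks : park n α ≡ just s) where

  private
    length≡n = proj₁ (proj₁ (proj₁ pf))
    inRange  = proj₂ (proj₁ (proj₁ pf))
    parked   = parkFrom-spec n [] α parks

  unique : Unique s
  unique = proj₁ (proj₂ parked)

  steps : Pointwise (UnitDisplaced n) α s
  steps = build inRange (proj₁ parked) (proj₂ pf s parks)
    where
    build : ∀ {α s} → All (λ a → 1 ≤ a × a ≤ n) α → Pointwise (λ a t → a ≤ t × t ≤ n) α s →
            All (_≤ 1) (displacements s α) → Pointwise (UnitDisplaced n) α s
    build [] [] _ = []
    build {a ∷ _} {t ∷ _} ((1≤a , _) ∷ inRange) ((a≤t , t≤n) ∷ parked) (d≤1 ∷ ds≤1) =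
      (1≤a , a≤t , t≤n , m∸n≤o⇒m≤o+n t a d≤1) ∷ build inRange parked ds≤1
      where
      m∸n≤o⇒m≤o+n : ∀ m n {o} → m ∸ n ≤ o → m ≤ o + n
      m∸n≤o⇒m≤o+n m n {o} le =
        ≤-trans (m≤n+m∸n m n) (≤-trans (+-monoʳ-≤ n le) (≤-reflexive (+-comm n o)))

  crossings≤1 : ∀ k → crossings k α s ≤ 1
  crossings≤1 k = unique⇒crossings≤1 (Pointwise.map (λ (_ , _ , _ , t≤1+a) → t≤1+a) steps) unique

  countLeq≡k+crossings : ∀ {k} → k ≤ n → countLeq k α ≡ k + crossings k α s
  countLeq≡k+crossings {k} k≤n =
    trans (countLeq-crossings k (Pointwise.map (λ (_ , a≤t , _) → a≤t) steps))
          (cong (_+ crossings k α s) (countLeq-permutation k≤n unique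
            (All-resp-Pointwise (λ (_ , a≤t , t≤n , _) (1≤a , _) → ≤-trans 1≤a a≤t , t≤n)
                                steps inRange)
            (trans (sym (Pointwise-length steps)) length≡n)))

  noCrossing⇒breakpoint : ∀ {k} → k ≤ n → crossings k α s ≡ 0 → Breakpoint α k
  noCrossing⇒breakpoint {k} k≤n c≡0 =
    trans (countLeq≡k+crossings k≤n) (trans (cong (k +_) c≡0) (+-identityʳ k))

  breakpoint⇒noCrossing : ∀ {k} → k ≤ n → Breakpoint α k → crossings k α s ≡ 0
  breakpoint⇒noCrossing {k} k≤n bp =
    +-cancelˡ-≡ k _ 0 (trans (sym (countLeq≡k+crossings k≤n)) (trans bp (sym (+-identityʳ k))))

  D≡sumTo-crossings : D n α ≡ sumTo (λ k → crossings k α s) (pred n)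
  D≡sumTo-crossings rewrite parks = sym (sumTo-crossings (pred n)
    (Pointwise.map (λ (1≤a , _ , t≤n , _) → 1≤a , ≤-trans t≤n (m≤n+m∸n n 1)) steps))

≤pred⇒< : ∀ {m n} → 1 ≤ m → m ≤ pred n → m < n
≤pred⇒< {n = zero}  (s≤s _) ()
≤pred⇒< {n = suc _} _       m≤n = s≤s m≤n

corollary2p5 : (n : ℕ) (α : List ℕ) → UnitIntervalPF n α →
    (Prime n α → D n α ≡ n ∸ 1) × (D n α ≡ n ∸ 1 → Prime n α)
corollary2p5 n α pf@((_ , s , parks) , _) = prime⇒D , D⇒prime
  where
  open UnitIntervalOutcome pf parks

  prime⇒D : Prime n α → D n α ≡ n ∸ 1
  prime⇒D prime = trans D≡sumTo-crossings (sumTo-ones (pred n) crossed)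
    where
    crossed : ∀ {k} → 1 ≤ k → k ≤ pred n → crossings k α s ≡ 1
    crossed {k} 1≤k k≤pred[n] = ≤-antisym (crossings≤1 k) (n≢0⇒n>0 λ c≡0 →
      <⇒≢ (≤pred⇒< 1≤k k≤pred[n]) (prime k 1≤k k≤n (noCrossing⇒breakpoint k≤n c≡0)))
      where k≤n = ≤pred⇒≤ k≤pred[n]

  D⇒prime : D n α ≡ n ∸ 1 → Prime n α
  D⇒prime D≡ k 1≤k k≤n bp with k ≤? pred n
  ... | no k≰pred[n] = ≤-antisym k≤n (≮⇒≥ (k≰pred[n] ∘ <⇒≤pred))
  ... | yes k≤pred[n] = contradiction (trans (sym D≡sumTo-crossings) D≡)
        (<⇒≢ (sumTo-< (pred n) crossings≤1 1≤k k≤pred[n] (breakpoint⇒noCrossing k≤n bp)))
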